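{- Let $S\subseteq\mathbb{Z}^2$ be an antimatroidal point set and let $(x,y)\in\mathcal{B}_{lower}$. Then: (i) if $A=(x,z)\in S$ and $A\notin\mathcal{B}_{lower}$, then $z>y$; (ii) if $A=(z,y)\in S$ and $A\notin\mathcal{B}_{lower}$, then $z<x$.
   Context: A point $A=(x_A,y_A)\in\mathbb{Z}^2$ is regarded as a multiset over $\{x,y\}$; $A\subseteq B$ means $x_A\le x_B$ and $y_A\le y_B$. A finite nonempty set $S\subseteq\mathbb{Z}^2$ is an antimatroidal point set if (A1) for every $(x_A,y_A)\in S$ with $(x_A,y_A)\neq(0,0)$, either $(x_A-1,y_A)\in S$ or $(x_A,y_A-1)\in S$; (A2) for all $A,B\in S$ with $A\not\subseteq B$: if $x_A\ge x_B$ and $y_A\ge y_B$ then $(x_B+1,y_B)\in S$ or $(x_B,y_B+1)\in S$; if $x_A\le x_B$ and $y_A\ge y_B$ then $(x_B,y_B+1)\in S$; if $x_A\ge x_B$ and $y_A\le y_B$ then $(x_B+1,y_B)\in S$. The lower boundary is $\mathcal{B}_{lower}=\{(x,y)\in S:(x+1,y)\notin S\ \vee\ (x,y-1)\notin S\ \vee\ (x+1,y-1)\notin S\}$. -}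

module Defs where

open import Data.Integer using (ℤ; _+_; _-_; _≤_; _≥_; 0ℤ; 1ℤ)
open import Data.Product using (_×_; _,_)
open import Data.Sum using (_⊎_)
open import Data.List using (List; [])
open import Data.List.Membership.Propositional using (_∈_; _∉_)
open import Relation.Binary.PropositionalEquality using (_≡_; _≢_)
open import Relation.Nullary using (¬_)

Point : Set
Point = ℤ × ℤ

-- A finite point set, given by a list enumerating its elements
-- (duplicates are harmless: only membership matters).
PointSet : Set
PointSet = List Point

-- Multiset inclusion A ⊆ B : x_A ≤ x_B and y_A ≤ y_B.
_⊆ₚ_ : Point → Point → Set
(xa , ya) ⊆ₚ (xb , yb) = (xa ≤ xb) × (ya ≤ yb)

A1 : PointSet → Set
A1 S = ∀ xa ya → (xa , ya) ∈ S → (xa , ya) ≢ (0ℤ , 0ℤ) →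
       ((xa - 1ℤ , ya) ∈ S) ⊎ ((xa , ya - 1ℤ) ∈ S)

A2 : PointSet → Set
A2 S = ∀ xa ya xb yb → (xa , ya) ∈ S → (xb , yb) ∈ S →
       ¬ ((xa , ya) ⊆ₚ (xb , yb)) →
       ((xa ≥ xb → ya ≥ yb → ((xb + 1ℤ , yb) ∈ S) ⊎ ((xb , yb + 1ℤ) ∈ S))
        × (xa ≤ xb → ya ≥ yb → (xb , yb + 1ℤ) ∈ S)
        × (xa ≥ xb → ya ≤ yb → (xb + 1ℤ , yb) ∈ S))

record Antimatroidal (S : PointSet) : Set where
  field
    nonempty : S ≢ []
    a1 : A1 S
    a2 : A2 S

InLower : PointSet → Point → Set
InLower S (x , y) = ((x , y) ∈ S) ×
  (((x + 1ℤ , y) ∉ S) ⊎ ((x , y - 1ℤ) ∉ S) ⊎ ((x + 1ℤ , y - 1ℤ) ∉ S))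

-- A lower-boundary point (x , y) has no points of S strictly below it in both
-- columns x and x + 1: (A2) applied with A = (x , y) lets any such point climb its
-- column up to height y, which would put (x + 1 , y), (x , y - 1) and (x + 1 , y - 1)
-- into S.  Part (i) is immediate from this, since an interior point (x , z) with
-- z ≤ y supplies (x , z - 1) and (x + 1 , z - 1).  For part (ii), an interior point
-- (z , y) with z ≥ x supplies (z + 1 , y - 1); descending from it by (A1) towards
-- the origin meets columns x and x + 1 at heights below y.
module Submission where

open import Defs
open import Data.Integer using (ℤ; _<_; _>_)
open import Data.Product using (_×_; _,_)
open import Data.List.Membership.Propositional using (_∈_)
open import Relation.Nullary using (¬_)

open import Data.Integer using (_+_; _-_; -_; _≤_; 0ℤ; 1ℤ; -1ℤ; +_; ∣_∣; _≟_; _≤?_)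
open import Data.Integer.Properties
import Data.Nat as ℕ
open import Data.Nat.Induction using (<-wellFounded)
open import Data.Product using (∃-syntax)
open import Data.Product.Properties using (≡-dec)
open import Data.Sum using (inj₁; inj₂)
open import Data.Empty using (⊥; ⊥-elim)
open import Data.List.Relation.Unary.All using (lookup)
open import Data.List.Extrema ≤-totalOrder using (argmin; f[argmin]≤f[xs])
open import Induction.WellFounded using (module All)
import Relation.Binary.Construct.On as On
open import Relation.Binary.PropositionalEquality using (_≡_; refl; trans; subst)
open import Relation.Nullary using (yes; no)
open import Relation.Nullary.Decidable using (decidable-stable)

open import Data.List.Membership.DecPropositional (≡-dec _≟_ _≟_) using (_∈?_)

i-1<i : ∀ i → i - 1ℤ < i
i-1<i i = i≤pred[j]⇒i<j (≤-reflexive (+-comm i -1ℤ))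

i<j⇒i≤j-1 : ∀ {i j} → i < j → i ≤ j - 1ℤ
i<j⇒i≤j-1 {i} {j} i<j = subst (i ≤_) (+-comm -1ℤ j) (i<j⇒i≤pred[j] i<j)

i-1+1≡i : ∀ i → i - 1ℤ + 1ℤ ≡ i
i-1+1≡i i = trans (+-assoc i -1ℤ 1ℤ) (+-identityʳ i)

∣i-m∣<∣j-m∣ : ∀ {m i j} → m ≤ i → i < j → ∣ i - m ∣ ℕ.< ∣ j - m ∣
∣i-m∣<∣j-m∣ {m} {i} {j} m≤i i<j = drop‿+<+ (begin-strict
  + ∣ i - m ∣  ≡⟨ 0≤i⇒+∣i∣≡i (i≤j⇒0≤j-i m≤i) ⟩
  i - m        <⟨ +-monoˡ-< (- m) i<j ⟩
  j - m        ≡⟨ 0≤i⇒+∣i∣≡i (i≤j⇒0≤j-i (≤-trans m≤i (<⇒≤ i<j))) ⟨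
  + ∣ j - m ∣  ∎)
  where open ≤-Reasoning

<-rec-above : (m : ℤ) (P : ℤ → Set) →
  (∀ {i} → m ≤ i → (∀ {j} → m ≤ j → j < i → P j) → P i) →
  ∀ {i} → m ≤ i → P i
<-rec-above m P step {i} =
  All.wfRec (On.wellFounded (λ k → ∣ k - m ∣) <-wellFounded) _ (λ k → m ≤ k → P k)
    (λ _ rec m≤k → step m≤k (λ m≤j j<k → rec (∣i-m∣<∣j-m∣ m≤j j<k) m≤j)) i

upward-induction : (P : ℤ → Set) {u : ℤ} →
  (∀ {t} → t < u → P t → P (t + 1ℤ)) →
  ∀ {w t} → P w → w ≤ t → t ≤ u → P t
upward-induction P {u} step {w} Pw w≤t = <-rec-above w (λ t → t ≤ u → P t) go w≤t
  where
  go : ∀ {t} → w ≤ t → (∀ {s} → w ≤ s → s < t → s ≤ u → P s) → t ≤ u → P t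
  go {t} w≤t rec t≤u with w ≟ t
  ... | yes refl = Pw
  ... | no w≢t = subst P (i-1+1≡i t) (step t-1<u (rec w≤t-1 (i-1<i t) (<⇒≤ t-1<u)))
    where
    t-1<u : t - 1ℤ < u
    t-1<u = <-≤-trans (i-1<i t) t≤u
    w≤t-1 : w ≤ t - 1ℤ
    w≤t-1 = i<j⇒i≤j-1 (≤∧≢⇒< w≤t w≢t)

size : Point → ℤ
size (a , b) = a + b

size-induction : (S : PointSet) (P : Point → Set) →
  (∀ {p} → p ∈ S → (∀ {q} → q ∈ S → size q < size p → P q) → P p) →
  ∀ {p} → p ∈ S → P p
size-induction S P step p∈S = <-rec-above m Q go (m≤size p∈S) p∈S refl
  where
  m : ℤ
  m = size (argmin size (0ℤ , 0ℤ) S)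
  m≤size : ∀ {p} → p ∈ S → m ≤ size p
  m≤size = lookup (f[argmin]≤f[xs] _ S)
  Q : ℤ → Set
  Q i = ∀ {p} → p ∈ S → size p ≡ i → P p
  go : ∀ {i} → m ≤ i → (∀ {j} → m ≤ j → j < i → Q j) → Q i
  go _ rec p∈S refl = step p∈S (λ q∈S q<p → rec (m≤size q∈S) q<p q∈S refl)

¬InLower⇒interior : ∀ {S a b} → (a , b) ∈ S → ¬ InLower S (a , b) →
  ((a + 1ℤ , b) ∈ S) × ((a , b - 1ℤ) ∈ S) × ((a + 1ℤ , b - 1ℤ) ∈ S)
¬InLower⇒interior {S} p∈S ¬low =
    stable (λ ∉ → ¬low (p∈S , inj₁ ∉))
  , stable (λ ∉ → ¬low (p∈S , inj₂ (inj₁ ∉)))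
  , stable (λ ∉ → ¬low (p∈S , inj₂ (inj₂ ∉)))
  where
  stable : ∀ {q} → ¬ ¬ q ∈ S → q ∈ S
  stable {q} = decidable-stable (q ∈? S)

module _ {S : PointSet} (a1 : A1 S) where

  A1-induction : (P : ℤ → ℤ → Set) →
    ((0ℤ , 0ℤ) ∈ S → P 0ℤ 0ℤ) →
    (∀ {a b} → (a , b) ∈ S → P (a - 1ℤ) b → P a b) →
    (∀ {a b} → (a , b) ∈ S → P a (b - 1ℤ) → P a b) →
    ∀ {a b} → (a , b) ∈ S → P a b
  A1-induction P origin left down = size-induction S P′ step
    where
    P′ : Point → Set
    P′ (a , b) = P a b
    step : ∀ {p} → p ∈ S → (∀ {q} → q ∈ S → size q < size p → P′ q) → P′ p
    step {a , b} p∈S rec with ≡-dec _≟_ _≟_ (a , b) (0ℤ , 0ℤ)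
    ... | yes refl = origin p∈S
    ... | no p≢0 with a1 a b p∈S p≢0
    ...   | inj₁ l∈S = left p∈S (rec l∈S (+-monoˡ-< b (i-1<i a)))
    ...   | inj₂ d∈S = down p∈S (rec d∈S (+-monoʳ-< a (i-1<i b)))

  column-nonneg : ∀ {a b} → (a , b) ∈ S → 0ℤ ≤ a
  column-nonneg = A1-induction (λ a _ → 0ℤ ≤ a)
    (λ _ → ≤-refl) (λ {a} _ 0≤a-1 → ≤-trans 0≤a-1 (<⇒≤ (i-1<i a))) (λ _ 0≤a → 0≤a)

  column-below : ∀ {a b} → (a , b) ∈ S → ∀ {c} → 0ℤ ≤ c → c ≤ a → ∃[ w ] (w ≤ b × (c , w) ∈ S)
  column-below = A1-induction P origin left down
    where
    P : ℤ → ℤ → Set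
    P a b = ∀ {c} → 0ℤ ≤ c → c ≤ a → ∃[ w ] (w ≤ b × (c , w) ∈ S)
    origin : (0ℤ , 0ℤ) ∈ S → P 0ℤ 0ℤ
    origin o∈S 0≤c c≤0 with ≤-antisym c≤0 0≤c
    ... | refl = 0ℤ , ≤-refl , o∈S
    left : ∀ {a b} → (a , b) ∈ S → P (a - 1ℤ) b → P a b
    left {a} {b} p∈S ih {c} 0≤c c≤a with c ≟ a
    ... | yes refl = b , ≤-refl , p∈S
    ... | no c≢a = ih 0≤c (i<j⇒i≤j-1 (≤∧≢⇒< c≤a c≢a))
    down : ∀ {a b} → (a , b) ∈ S → P a (b - 1ℤ) → P a b
    down {b = b} _ ih 0≤c c≤a with ih 0≤c c≤a
    ... | w , w≤b-1 , q∈S = w , ≤-trans w≤b-1 (<⇒≤ (i-1<i b)) , q∈S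

module _ {S : PointSet} (a2 : A2 S) {x y : ℤ} (xy∈S : (x , y) ∈ S) where

  climb-step : ∀ {c w} → x ≤ c → w < y → (c , w) ∈ S → (c , w + 1ℤ) ∈ S
  climb-step {c} {w} x≤c w<y cw∈S =
    let (_ , up , _) = a2 x y c w xy∈S cw∈S (λ (_ , y≤w) → <⇒≱ w<y y≤w)
    in up x≤c (<⇒≤ w<y)

  climb : ∀ {c w t} → x ≤ c → (c , w) ∈ S → w ≤ t → t ≤ y → (c , t) ∈ S
  climb {c} x≤c = upward-induction (λ t → (c , t) ∈ S) (climb-step x≤c)

  supported-below⇒¬InLower : ∀ {w w′} → (x , w) ∈ S → (x + 1ℤ , w′) ∈ S →
    w ≤ y - 1ℤ → w′ ≤ y - 1ℤ → ¬ InLower S (x , y)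
  supported-below⇒¬InLower _ x′w′∈S _ w′≤y-1 (_ , inj₁ ∉) =
    ∉ (climb (i≤i+j x 1ℤ) x′w′∈S (≤-trans w′≤y-1 (<⇒≤ (i-1<i y))) ≤-refl)
  supported-below⇒¬InLower xw∈S _ w≤y-1 _ (_ , inj₂ (inj₁ ∉)) =
    ∉ (climb ≤-refl xw∈S w≤y-1 (<⇒≤ (i-1<i y)))
  supported-below⇒¬InLower _ x′w′∈S _ w′≤y-1 (_ , inj₂ (inj₂ ∉)) =
    ∉ (climb (i≤i+j x 1ℤ) x′w′∈S w′≤y-1 (<⇒≤ (i-1<i y)))

lemma3 : (S : PointSet) → Antimatroidal S → (x y : ℤ) → InLower S (x , y) →
    (∀ z → (x , z) ∈ S → ¬ InLower S (x , z) → z > y)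
    × (∀ z → (z , y) ∈ S → ¬ InLower S (z , y) → z < x)
lemma3 S am x y low@(xy∈S , _) = same-column , same-row
  where
  open Antimatroidal am
  ¬low : ∀ {w w′} → (x , w) ∈ S → (x + 1ℤ , w′) ∈ S → w ≤ y - 1ℤ → w′ ≤ y - 1ℤ → ⊥
  ¬low xw∈S x′w′∈S w≤y-1 w′≤y-1 = supported-below⇒¬InLower a2 xy∈S xw∈S x′w′∈S w≤y-1 w′≤y-1 low

  same-column : ∀ z → (x , z) ∈ S → ¬ InLower S (x , z) → z > y
  same-column z xz∈S ¬lowz with z ≤? y
  ... | no z≰y = ≰⇒> z≰y
  ... | yes z≤y with ¬InLower⇒interior xz∈S ¬lowz
  ...   | _ , below , below-right = ⊥-elim (¬low below below-right z-1≤y-1 z-1≤y-1)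
    where
    z-1≤y-1 : z - 1ℤ ≤ y - 1ℤ
    z-1≤y-1 = +-monoˡ-≤ -1ℤ z≤y

  same-row : ∀ z → (z , y) ∈ S → ¬ InLower S (z , y) → z < x
  same-row z zy∈S ¬lowz with x ≤? z
  ... | no x≰z = ≰⇒> x≰z
  ... | yes x≤z with ¬InLower⇒interior zy∈S ¬lowz
  ...   | _ , _ , z′y-1∈S =
    let (w , w≤y-1 , xw∈S) = column-below a1 z′y-1∈S 0≤x (≤-trans x≤z (i≤i+j z 1ℤ))
        (w′ , w′≤y-1 , x′w′∈S) = column-below a1 z′y-1∈S (≤-trans 0≤x (i≤i+j x 1ℤ)) (+-monoˡ-≤ 1ℤ x≤z)
    in ⊥-elim (¬low xw∈S x′w′∈S w≤y-1 w′≤y-1)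
    where
    0≤x : 0ℤ ≤ x
    0≤x = column-nonneg a1 xy∈S
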